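{- Let $1\le n<\omega$ be standard. Provably in $\mathsf{RCA}_0$: given a finite coloring $c:\mathbb{N}^n\to\{0,\dots,k-1\}$, Player $\oplus$ has a winning strategy in $\mathsf{G}_n(c)$ if and only if there is a strong lexicographic embedding $h:\mathbb{N}^n\to\mathbb{N}^n$ such that $c\circ h$ is constant.
   Context: The game $\mathsf{G}_n(c)$: Player $\oplus$ first chooses a color $d<k$; then Player $\ominus$ and Player $\oplus$ alternately play $a_1,b_1,\dots,a_n,b_n$ with $a_i\le b_i$; Player $\oplus$ wins iff $c(b_1,\dots,b_n)=d$. Order $\mathbb{N}^n$ lexicographically; a lexicographic embedding is $h=(h_1,\dots,h_n):\mathbb{N}^n\to\mathbb{N}^n$ strictly increasing for this order. It is strong if for each $i=1,\dots,n$, $x_1=y_1,\dots,x_i=y_i$ implies $h_i(x_1,\dots,x_n)=h_i(y_1,\dots,y_n)$. -}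

module Defs where

open import Data.Unit using (⊤)
open import Data.Nat using (ℕ; _≤_; _<_)
open import Data.Fin using (Fin; toℕ)
open import Data.Vec using (Vec; []; _∷_; lookup)
open import Data.List using (List; []; _∷_; _++_; [_])
open import Data.Product using (Σ; _×_; _,_)
open import Relation.Binary.PropositionalEquality using (_≡_)
open import Data.Vec.Relation.Binary.Lex.Strict using (Lex-<)

Coloring : ℕ → ℕ → Set
Coloring n k = Vec ℕ n → Fin k

_<lex_ : ∀ {n} → Vec ℕ n → Vec ℕ n → Set
_<lex_ = Lex-< _≡_ _<_

IsLexEmbedding : ∀ {n} → (Vec ℕ n → Vec ℕ n) → Set
IsLexEmbedding h = ∀ x y → x <lex y → h x <lex h y

-- Strong: for each coordinate i (0-indexed here), if x and y agree on
-- coordinates 0..i then h(x) and h(y) agree on coordinate i.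
IsStrong : ∀ {n} → (Vec ℕ n → Vec ℕ n) → Set
IsStrong {n} h = ∀ (i : Fin n) (x y : Vec ℕ n) →
  (∀ (j : Fin n) → toℕ j ≤ toℕ i → lookup x j ≡ lookup y j) →
  lookup (h x) i ≡ lookup (h y) i

IsStrongLexEmbedding : ∀ {n} → (Vec ℕ n → Vec ℕ n) → Set
IsStrongLexEmbedding h = IsLexEmbedding h × IsStrong h

-- Strategy for Player ⊕ after the colour has been chosen: given the history
-- of previous rounds (a₁,b₁),…,(aᵢ₋₁,bᵢ₋₁) and the current move aᵢ of ⊖,
-- it returns bᵢ.
Strategy : Set
Strategy = List (ℕ × ℕ) → ℕ → ℕ

play : ∀ {m} → Strategy → List (ℕ × ℕ) → Vec ℕ m → Vec (ℕ × ℕ) m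
play σ hist [] = []
play σ hist (a ∷ as) = (a , σ hist a) ∷ play σ (hist ++ [ (a , σ hist a) ]) as

bsOf : ∀ {m} → Vec (ℕ × ℕ) m → Vec ℕ m
bsOf [] = []
bsOf ((a , b) ∷ r) = b ∷ bsOf r

AllLegal : ∀ {m} → Vec (ℕ × ℕ) m → Set
AllLegal [] = ⊤
AllLegal ((a , b) ∷ r) = (a ≤ b) × AllLegal r

Wins : ∀ {n k} → Coloring n k → Fin k → Strategy → Set
Wins {n} c d σ = ∀ (as : Vec ℕ n) →
  AllLegal (play σ [] as) × (c (bsOf (play σ [] as)) ≡ d)

PlusWins : ∀ {n k} → Coloring n k → Set
PlusWins {n} {k} c = Σ (Fin k) λ d → Σ Strategy λ σ → Wins c d σ

-- Both directions rest on one structural observation: a map on ℕ^(1+n) whose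
-- first output coordinate depends only on the first input coordinate is
-- "fibred", h (x ∷ xs) = F x ∷ G x xs, and h is a strong lexicographic
-- embedding exactly when F is strictly increasing and every G x is again a
-- strong lexicographic embedding of ℕ^n.  A strategy has the same shape: a
-- first answer a ↦ σ [] a, and for each first round a strategy for the
-- remaining n rounds.
--
-- (⇒) From a winning strategy σ we let ⊖ probe with 0, then always one more
--     than ⊕'s last answer; ⊕'s answers form a strictly increasing F, and the
--     strategies for the later rounds give G by recursion on n.
-- (⇐) From h we answer the first move a with F a and continue with the
--     strategy of G a.  Legality (a ≤ F a) needs F to be strictly increasing,
--     which follows from the fact that no strong lexicographic embedding maps
--     a point lexicographically below itself; both facts are proved together
--     by induction on n.

module Submission where

open import Defs
open import Data.Unit using (tt)
open import Data.Empty using (⊥-elim)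
open import Data.Nat using (ℕ; zero; suc; _≤_; _<_; z≤n; s≤s)
open import Data.Nat.Properties using (<-trans; ≤-<-trans; <-irrefl; ≤⇒≯; n<1+n; m≤n⇒m<n∨m≡n)
open import Data.Fin using (Fin; toℕ) renaming (zero to fz; suc to fs)
open import Data.Vec using (Vec; []; _∷_; lookup; tail; replicate)
open import Data.List using ([]; _∷_)
open import Data.Product using (Σ; _×_; _,_; proj₁; proj₂)
open import Data.Sum using (inj₁; inj₂)
open import Relation.Binary.PropositionalEquality using (_≡_; refl; sym; trans; cong; subst; subst₂; module ≡-Reasoning)
open import Relation.Nullary using (¬_)
open import Data.Vec.Relation.Binary.Lex.Core using (base; this; next; toSum)

StepIncreasing : (ℕ → ℕ) → Set
StepIncreasing f = ∀ x → f x < f (suc x)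

step-increasing⇒monotone : ∀ {f} → StepIncreasing f → ∀ {x y} → x < y → f x < f y
step-increasing⇒monotone inc {x} {suc y} (s≤s x≤y) with m≤n⇒m<n∨m≡n x≤y
... | inj₁ x<y  = <-trans (step-increasing⇒monotone inc x<y) (inc y)
... | inj₂ refl = inc x

step-increasing⇒inflationary : ∀ {f} → StepIncreasing f → ∀ x → x ≤ f x
step-increasing⇒inflationary inc zero    = z≤n
step-increasing⇒inflationary inc (suc x) = ≤-<-trans (step-increasing⇒inflationary inc x) (inc x)

lex-empty : ∀ {u v : Vec ℕ 0} → ¬ (u <lex v)
lex-empty {[]} {[]} (base ())

lex-tail : ∀ {n x} {xs ys : Vec ℕ n} → (x ∷ xs) <lex (x ∷ ys) → xs <lex ys
lex-tail (this x<x _) = ⊥-elim (<-irrefl refl x<x)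
lex-tail (next _ lt)  = lt

vec-eta : ∀ {n} (v : Vec ℕ (suc n)) → lookup v fz ∷ tail v ≡ v
vec-eta (x ∷ xs) = refl

lookup-tail : ∀ {n} (v : Vec ℕ (suc n)) (i : Fin n) → lookup (tail v) i ≡ lookup v (fs i)
lookup-tail (x ∷ xs) i = refl

fibred : ∀ {n} → (ℕ → ℕ) → (ℕ → Vec ℕ n → Vec ℕ n) → Vec ℕ (suc n) → Vec ℕ (suc n)
fibred F G (x ∷ xs) = F x ∷ G x xs

fibred-lex : ∀ {n F} {G : ℕ → Vec ℕ n → Vec ℕ n} → StepIncreasing F →
  (∀ x → IsLexEmbedding (G x)) → IsLexEmbedding (fibred F G)
fibred-lex incF lexG (x ∷ xs) (y ∷ ys) (this x<y _)   = this (step-increasing⇒monotone incF x<y) refl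
fibred-lex incF lexG (x ∷ xs) (x ∷ ys) (next refl lt) = next refl (lexG x xs ys lt)

fibred-strong : ∀ {n F} {G : ℕ → Vec ℕ n → Vec ℕ n} →
  (∀ x → IsStrong (G x)) → IsStrong (fibred F G)
fibred-strong strongG fz (x ∷ xs) (y ∷ ys) agree with agree fz z≤n
... | refl = refl
fibred-strong strongG (fs i) (x ∷ xs) (y ∷ ys) agree with agree fz z≤n
... | refl = strongG x i xs ys (λ j j≤i → agree (fs j) (s≤s j≤i))

headMap : ∀ {n} → (Vec ℕ (suc n) → Vec ℕ (suc n)) → ℕ → ℕ
headMap {n} h x = lookup (h (x ∷ replicate n 0)) fz

tailMap : ∀ {n} → (Vec ℕ (suc n) → Vec ℕ (suc n)) → ℕ → Vec ℕ n → Vec ℕ n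
tailMap h x xs = tail (h (x ∷ xs))

-- Every strong map is fibred: its first output coordinate depends only on
-- the first input coordinate.
strong⇒fibred : ∀ {n} (h : Vec ℕ (suc n) → Vec ℕ (suc n)) → IsStrong h →
  ∀ v → h v ≡ fibred (headMap h) (tailMap h) v
strong⇒fibred {n} h strong (x ∷ xs) =
  trans (sym (vec-eta (h (x ∷ xs)))) (cong (_∷ tailMap h x xs) sameHead)
  where
    sameHead : lookup (h (x ∷ xs)) fz ≡ headMap h x
    sameHead = strong fz (x ∷ xs) (x ∷ replicate n 0) λ { fz _ → refl ; (fs j) () }

tailMap-strong : ∀ {n} (h : Vec ℕ (suc n) → Vec ℕ (suc n)) → IsStrong h →
  ∀ x → IsStrong (tailMap h x)
tailMap-strong h strong x i xs ys agree =
  trans (lookup-tail (h (x ∷ xs)) i)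
    (trans (strong (fs i) (x ∷ xs) (x ∷ ys) agreeCons) (sym (lookup-tail (h (x ∷ ys)) i)))
  where
    agreeCons : ∀ j → toℕ j ≤ toℕ (fs i) → lookup (x ∷ xs) j ≡ lookup (x ∷ ys) j
    agreeCons fz     _         = refl
    agreeCons (fs j) (s≤s j≤i) = agree j j≤i

tailMap-lex : ∀ {n} (h : Vec ℕ (suc n) → Vec ℕ (suc n)) → IsStrongLexEmbedding h →
  ∀ x → IsLexEmbedding (tailMap h x)
tailMap-lex h (lex , strong) x xs ys xs<ys =
  lex-tail (subst₂ _<lex_ (strong⇒fibred h strong (x ∷ xs)) (strong⇒fibred h strong (x ∷ ys))
             (lex (x ∷ xs) (x ∷ ys) (next refl xs<ys)))

tailMap-strongLex : ∀ {n} (h : Vec ℕ (suc n) → Vec ℕ (suc n)) → IsStrongLexEmbedding h →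
  ∀ x → IsStrongLexEmbedding (tailMap h x)
tailMap-strongLex h H x = tailMap-lex h H x , tailMap-strong h (proj₂ H) x

-- If no fibre moves a point below itself, the base map is strictly
-- increasing: otherwise F x = F (x+1), and the whole fibre over x would lie
-- below the single point w = G (x+1) 0, in particular G x w <lex w.
headMap-increasing : ∀ {n} (h : Vec ℕ (suc n) → Vec ℕ (suc n)) → IsStrongLexEmbedding h →
  (∀ x v → ¬ (tailMap h x v <lex v)) → StepIncreasing (headMap h)
headMap-increasing {n} h (lex , strong) noDescent x
  with toSum (subst₂ _<lex_ (strong⇒fibred h strong (x ∷ w)) (strong⇒fibred h strong (suc x ∷ replicate n 0))
                (lex (x ∷ w) (suc x ∷ replicate n 0) (this (n<1+n x) refl)))
  where
    w : Vec ℕ n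
    w = tailMap h (suc x) (replicate n 0)
... | inj₁ Fx<Fsx   = Fx<Fsx
... | inj₂ (_ , lt) = ⊥-elim (noDescent x _ lt)

noDescent : ∀ {n} (h : Vec ℕ n → Vec ℕ n) → IsStrongLexEmbedding h → ∀ v → ¬ (h v <lex v)

strongLex-headIncreasing : ∀ {n} (h : Vec ℕ (suc n) → Vec ℕ (suc n)) →
  IsStrongLexEmbedding h → StepIncreasing (headMap h)
strongLex-headIncreasing h H =
  headMap-increasing h H (λ x → noDescent (tailMap h x) (tailMap-strongLex h H x))

noDescent {zero}  h _ v = lex-empty
noDescent {suc n} h H (x ∷ xs) hv<v with toSum (subst (_<lex (x ∷ xs)) (strong⇒fibred h (proj₂ H) (x ∷ xs)) hv<v)
... | inj₁ Fx<x     = ≤⇒≯ (step-increasing⇒inflationary (strongLex-headIncreasing h H) x) Fx<x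
... | inj₂ (_ , lt) = noDescent (tailMap h x) (tailMap-strongLex h H x) xs lt

after : Strategy → ℕ × ℕ → Strategy
after σ p hist = σ (p ∷ hist)

play-after : ∀ {m} σ p hist (as : Vec ℕ m) → play σ (p ∷ hist) as ≡ play (after σ p) hist as
play-after σ p hist []       = refl
play-after σ p hist (a ∷ as) = cong ((a , σ (p ∷ hist) a) ∷_) (play-after σ p _ as)

play-cons : ∀ {m} σ a (as : Vec ℕ m) →
  play σ [] (a ∷ as) ≡ (a , σ [] a) ∷ play (after σ (a , σ [] a)) [] as
play-cons σ a as = cong (_ ∷_) (play-after σ _ [] as)

LegalFor : ℕ → Strategy → Set
LegalFor n σ = ∀ (as : Vec ℕ n) → AllLegal (play σ [] as)

legal-first : ∀ {n} σ → LegalFor (suc n) σ → ∀ a → a ≤ σ [] a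
legal-first {n} σ legal a = proj₁ (legal (a ∷ replicate n 0))

legal-after : ∀ {n} σ → LegalFor (suc n) σ → ∀ a → LegalFor n (after σ (a , σ [] a))
legal-after σ legal a as = subst AllLegal (play-after σ _ [] as) (proj₂ (legal (a ∷ as)))

strategyOf : ∀ {n} → (Vec ℕ n → Vec ℕ n) → Strategy
strategyOf {zero}  h _                 _  = 0
strategyOf {suc n} h []                a  = headMap h a
strategyOf {suc n} h ((a , _) ∷ hist) a′ = strategyOf (tailMap h a) hist a′

strategyOf-outcome : ∀ {n} (h : Vec ℕ n → Vec ℕ n) → IsStrong h →
  ∀ as → bsOf (play (strategyOf h) [] as) ≡ h as
strategyOf-outcome {zero} h strong [] with h []
... | [] = refl
strategyOf-outcome {suc n} h strong (a ∷ as) = begin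
  bsOf (play (strategyOf h) [] (a ∷ as))
    ≡⟨ cong bsOf (play-cons (strategyOf h) a as) ⟩
  headMap h a ∷ bsOf (play (strategyOf (tailMap h a)) [] as)
    ≡⟨ cong (headMap h a ∷_) (strategyOf-outcome (tailMap h a) (tailMap-strong h strong a) as) ⟩
  fibred (headMap h) (tailMap h) (a ∷ as)
    ≡⟨ sym (strong⇒fibred h strong (a ∷ as)) ⟩
  h (a ∷ as) ∎
  where open ≡-Reasoning

-- Its moves are legal because F a ≥ a.
strategyOf-legal : ∀ {n} (h : Vec ℕ n → Vec ℕ n) → IsStrongLexEmbedding h →
  LegalFor n (strategyOf h)
strategyOf-legal {zero}  h H []       = tt
strategyOf-legal {suc n} h H (a ∷ as) =
  subst AllLegal (sym (play-cons (strategyOf h) a as))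
    (step-increasing⇒inflationary (strongLex-headIncreasing h H) a ,
     strategyOf-legal (tailMap h a) (tailMap-strongLex h H a) as)

-- ⊖ probes σ's first answer with 0, 1 + (previous answer), …; the answers
-- form a strictly increasing sequence when σ is legal.
probe : Strategy → ℕ → ℕ
probe σ zero    = 0
probe σ (suc t) = suc (σ [] (probe σ t))

response : Strategy → ℕ → ℕ
response σ t = σ [] (probe σ t)

firstRound : Strategy → ℕ → ℕ × ℕ
firstRound σ x = probe σ x , response σ x

response-increasing : ∀ σ → (∀ a → a ≤ σ [] a) → StepIncreasing (response σ)
response-increasing σ legal t = legal (suc (response σ t))

embeddingOf : ∀ {n} → Strategy → Vec ℕ n → Vec ℕ n
embeddingOf {zero}  σ v = v
embeddingOf {suc n} σ v = fibred (response σ) (λ x → embeddingOf (after σ (firstRound σ x))) v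

-- The moves of ⊖ realising the point embeddingOf σ x as the answers of σ.
movesOf : ∀ {n} → Strategy → Vec ℕ n → Vec ℕ n
movesOf σ []       = []
movesOf σ (x ∷ xs) = probe σ x ∷ movesOf (after σ (firstRound σ x)) xs

embeddingOf-outcome : ∀ {n} σ (x : Vec ℕ n) → bsOf (play σ [] (movesOf σ x)) ≡ embeddingOf σ x
embeddingOf-outcome σ []       = refl
embeddingOf-outcome σ (x ∷ xs) =
  trans (cong bsOf (play-cons σ (probe σ x) _))
        (cong (response σ x ∷_) (embeddingOf-outcome (after σ (firstRound σ x)) xs))

embeddingOf-lex : ∀ {n} σ → LegalFor n σ → IsLexEmbedding (embeddingOf {n} σ)
embeddingOf-lex {zero}  σ legal x y x<y = x<y
embeddingOf-lex {suc n} σ legal =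
  fibred-lex (response-increasing σ (legal-first σ legal))
             (λ x → embeddingOf-lex (after σ (firstRound σ x)) (legal-after σ legal (probe σ x)))

embeddingOf-strong : ∀ {n} σ → IsStrong (embeddingOf {n} σ)
embeddingOf-strong {zero}  σ ()
embeddingOf-strong {suc n} σ = fibred-strong (λ x → embeddingOf-strong (after σ (firstRound σ x)))

proposition2p15 : (n k : ℕ) → 1 ≤ n → (c : Coloring n k) →
    (PlusWins c → Σ (Vec ℕ n → Vec ℕ n) (λ h → IsStrongLexEmbedding h × Σ (Fin k) (λ d → ∀ x → c (h x) ≡ d)))
    × (Σ (Vec ℕ n → Vec ℕ n) (λ h → IsStrongLexEmbedding h × Σ (Fin k) (λ d → ∀ x → c (h x) ≡ d)) → PlusWins c)
proposition2p15 n k _ c = winning⇒embedding , embedding⇒winning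
  where
    winning⇒embedding : PlusWins c →
      Σ (Vec ℕ n → Vec ℕ n) (λ h → IsStrongLexEmbedding h × Σ (Fin k) (λ d → ∀ x → c (h x) ≡ d))
    winning⇒embedding (d , σ , wins) =
      embeddingOf σ ,
      (embeddingOf-lex σ (λ as → proj₁ (wins as)) , embeddingOf-strong σ) ,
      d , λ x → trans (cong c (sym (embeddingOf-outcome σ x))) (proj₂ (wins (movesOf σ x)))

    embedding⇒winning : Σ (Vec ℕ n → Vec ℕ n) (λ h → IsStrongLexEmbedding h × Σ (Fin k) (λ d → ∀ x → c (h x) ≡ d)) →
      PlusWins c
    embedding⇒winning (h , H , d , constant) =
      d , strategyOf h ,
      λ as → strategyOf-legal h H as , trans (cong c (strategyOf-outcome h (proj₂ H) as)) (constant as)
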